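{- Let $G$ be a graph and $x\in V(G)$ such that $G\setminus x$ is a forest. Then either $V(G)=N[x]$ and $G\setminus x$ has no edges, or $V(G)\setminus N[x]$ contains a vertex of degree at most one in $G$, or $G$ contains an induced cycle $C$ containing $x$ such that every vertex of $V(C)\setminus\{x\}$, except possibly one, has degree two in $G$.
   Context: All graphs are finite and simple; $N[x]=N(x)\cup\{x\}$. -}

module Defs where

open import Data.Nat using (ℕ; zero; suc; _+_; _≤_)
open import Data.Nat.DivMod using (_mod_)
open import Data.Fin using (Fin; toℕ; punchIn)
open import Data.Bool using (Bool; true; false; if_then_else_)
open import Data.List using (List; map)
open import Data.Nat.ListAction using (sum)
open import Data.List using (allFin)
open import Data.Product using (Σ; ∃; _×_)
open import Data.Sum using (_⊎_)
open import Function.Definitions using (Injective)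
open import Relation.Binary.PropositionalEquality using (_≡_; _≢_)
open import Relation.Nullary using (¬_)

record Graph (n : ℕ) : Set where
  field
    adj   : Fin n → Fin n → Bool
    sym   : ∀ u v → adj u v ≡ adj v u
    irrfl : ∀ v → adj v v ≡ false
open Graph public

deg : ∀ {n} → Graph n → Fin n → ℕ
deg G u = sum (map (λ v → if adj G u v then 1 else 0) (allFin _))

-- G ∖ x : the graph obtained by deleting vertex x (vertices of Fin n are
-- identified with the vertices of G other than x via punchIn x)
_∖_ : ∀ {n} → Graph (suc n) → Fin (suc n) → Graph n
G ∖ x = record
  { adj   = λ u v → adj G (punchIn x u) (punchIn x v)
  ; sym   = λ u v → sym G (punchIn x u) (punchIn x v)
  ; irrfl = λ v → irrfl G (punchIn x v) }

next : ∀ {k} → Fin (suc k) → Fin (suc k)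
next {k} i = suc (toℕ i) mod (suc k)

record Cycle {n : ℕ} (G : Graph n) : Set where
  field
    m     : ℕ
    vtx   : Fin (3 + m) → Fin n
    inj   : Injective _≡_ _≡_ vtx
    edges : ∀ i → adj G (vtx i) (vtx (next i)) ≡ true
open Cycle public

Induced : ∀ {n} {G : Graph n} → Cycle G → Set
Induced {G = G} C =
  ∀ i j → adj G (vtx C i) (vtx C j) ≡ true → (j ≡ next i) ⊎ (i ≡ next j)

Forest : ∀ {n} → Graph n → Set
Forest G = ¬ Cycle G

OnCycle : ∀ {n} {G : Graph n} → Cycle G → Fin n → Set
OnCycle C v = ∃ λ i → vtx C i ≡ v

-- Suppose no vertex outside N[x] has degree at most one, and call a path t, q₁, …, qₖ, x of G
-- (k ≥ 1) whose inner vertices qᵢ all have degree 2 a pendant path at t. Exploring the forest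
-- G ∖ x beyond a directed edge p → c yields the required cycle or a pendant path at p starting
-- with c: a leaf of G ∖ x is adjacent to x and ends a pendant path; a vertex c of degree 2 that
-- is not adjacent to x passes the pendant path found beyond it back to p; if c is adjacent to x,
-- then x, c and a pendant path at c form the cycle; otherwise c has a third neighbour, beyond
-- which a second pendant path at c is found, and the two pendant paths form the cycle, with c
-- as the one vertex whose degree may differ from 2. Pendant paths at c with different first
-- vertices are disjoint, because a vertex of degree 2 can only be entered through its two
-- neighbours on its path. An edge uv of G ∖ x starts the exploration, u being treated like c;
-- it terminates because the explored walk is a path of the forest G ∖ x.

module Submission where

open import Defs hiding (sym)
open import Data.Nat using (ℕ; zero; suc; _+_; _≤_; _<_; _%_; _≤?_; z≤n; s≤s; s≤s⁻¹)
open import Data.Nat.Properties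
  using (m≤m+n; +-assoc; n≤1+n; +-monoˡ-≤; +-monoʳ-≤; +-mono-≤; ≤-refl; ≤-trans; ≤-reflexive;
         ≤-antisym; <⇒≱; m<m+n; +-suc; +-commutativeSemigroup)
  renaming (_≟_ to _≟ℕ_)
open import Algebra.Properties.CommutativeSemigroup +-commutativeSemigroup using (x∙yz≈y∙xz)
open import Data.Nat.DivMod using (m<n⇒m%n≡m; n%n≡0)
open import Data.Nat.ListAction using (sum)
open import Data.Fin using (Fin; zero; suc; toℕ; fromℕ; inject₁; punchIn; punchOut)
open import Data.Fin.Properties
  using (toℕ-injective; toℕ-fromℕ<; toℕ-fromℕ; toℕ-inject₁; toℕ<n; punchIn-punchOut; punchInᵢ≢i;
         punchIn-injective; punchOut-injective; suc-injective; injective⇒≤; any?)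
  renaming (_≟_ to _≟F_)
open import Data.Fin.Relation.Unary.Top using (view; ‵fromℕ; ‵inject₁)
open import Data.Bool using (true; false; if_then_else_)
open import Data.Bool.Properties using (¬-not) renaming (_≟_ to _≟B_)
open import Data.List using (List; []; _∷_; _++_; [_]; length; lookup; reverse; reverseAcc; tabulate)
open import Data.List.Properties using (map-tabulate; ++-assoc; reverse-++; unfold-reverse)
open import Data.List.Relation.Unary.Any using (here; there; index)
open import Data.List.Relation.Unary.Any.Properties using (lookup-index; reverse⁻)
open import Data.List.Relation.Unary.All as All using (All; []; _∷_)
import Data.List.Relation.Unary.All.Properties as Allₚ
open import Data.List.Relation.Unary.AllPairs using ([]; _∷_)
open import Data.List.Relation.Unary.Linked as Linked using (Linked; []; [-]; _∷_)
open import Data.List.Relation.Unary.Unique.Propositional using (Unique)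
import Data.List.Relation.Unary.Unique.Propositional.Properties as Unique
open import Data.List.Relation.Binary.Disjoint.Propositional using (Disjoint)
open import Data.List.Relation.Binary.Permutation.Propositional
  using (_↭_; prep; ↭-sym; ↭⇒↭ₛ; module PermutationReasoning)
open import Data.List.Relation.Binary.Permutation.Propositional.Properties using (shift; ↭-reverse; ++⁺ˡ)
open import Data.List.Relation.Binary.Permutation.Setoid.Properties using (Unique-resp-↭)
open import Data.List.Membership.Propositional using (_∈_; _∉_)
open import Data.List.Membership.Propositional.Properties using (∈-lookup; ∈-∃++; ∈-++⁺ʳ; ∈-++⁻)
open import Data.Product using (Σ; ∃; ∃₂; _×_; _,_; proj₁; proj₂)
open import Data.Sum using (_⊎_; inj₁; inj₂; swap; [_,_]′)
open import Data.Empty using (⊥-elim)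
open import Function using (_∘_; case_of_)
open import Relation.Binary.PropositionalEquality
  using (_≡_; _≢_; refl; sym; trans; cong; cong₂; subst; subst₂; setoid; ≢-sym; module ≡-Reasoning)
open import Relation.Nullary using (¬_; yes; no)
open import Relation.Nullary.Decidable using (¬?; _×-dec_)

sum-tabulate-punchIn : ∀ {N} (g : Fin (suc N) → ℕ) i →
                       sum (tabulate g) ≡ g i + sum (tabulate (g ∘ punchIn i))
sum-tabulate-punchIn g zero = refl
sum-tabulate-punchIn {suc N} g (suc i) = begin
  g zero + sum (tabulate (g ∘ suc))
    ≡⟨ cong (g zero +_) (sum-tabulate-punchIn (g ∘ suc) i) ⟩
  g zero + (g (suc i) + sum (tabulate (g ∘ suc ∘ punchIn i)))
    ≡⟨ x∙yz≈y∙xz (g zero) (g (suc i)) _ ⟩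
  g (suc i) + (g zero + sum (tabulate (g ∘ suc ∘ punchIn i))) ∎
  where open ≡-Reasoning

sum-tabulate-zero : ∀ {N} (g : Fin N → ℕ) → (∀ i → g i ≡ 0) → sum (tabulate g) ≡ 0
sum-tabulate-zero {zero} g g≡0 = refl
sum-tabulate-zero {suc N} g g≡0 = cong₂ _+_ (g≡0 zero) (sum-tabulate-zero (g ∘ suc) (g≡0 ∘ suc))

≤-sum-tabulate : ∀ {N} (g : Fin N → ℕ) i → g i ≤ sum (tabulate g)
≤-sum-tabulate {suc N} g i =
  ≤-trans (m≤m+n (g i) _) (≤-reflexive (sym (sum-tabulate-punchIn g i)))

+-≤-sum-tabulate : ∀ {N} (g : Fin N → ℕ) {i j} → i ≢ j → g i + g j ≤ sum (tabulate g)
+-≤-sum-tabulate {suc N} g {i} {j} i≢j = begin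
  g i + g j                             ≡⟨ cong (λ k → g i + g k) (sym (punchIn-punchOut i≢j)) ⟩
  g i + g (punchIn i j′)                ≤⟨ +-monoʳ-≤ (g i) (≤-sum-tabulate (g ∘ punchIn i) j′) ⟩
  g i + sum (tabulate (g ∘ punchIn i))  ≡⟨ sym (sum-tabulate-punchIn g i) ⟩
  sum (tabulate g)                      ∎
  where
  open Data.Nat.Properties.≤-Reasoning
  j′ = punchOut i≢j

+-+-≤-sum-tabulate : ∀ {N} (g : Fin N → ℕ) {i j k} → i ≢ j → i ≢ k → j ≢ k →
                     g i + g j + g k ≤ sum (tabulate g)
+-+-≤-sum-tabulate {suc N} g {i} {j} {k} i≢j i≢k j≢k = begin
  g i + g j + g k                              ≡⟨ +-assoc (g i) (g j) (g k) ⟩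
  g i + (g j + g k)                            ≡⟨ cong₂ (λ a b → g i + (g a + g b))
                                                        (sym (punchIn-punchOut i≢j)) (sym (punchIn-punchOut i≢k)) ⟩
  g i + (g (punchIn i j′) + g (punchIn i k′))  ≤⟨ +-monoʳ-≤ (g i) (+-≤-sum-tabulate (g ∘ punchIn i) j′≢k′) ⟩
  g i + sum (tabulate (g ∘ punchIn i))         ≡⟨ sym (sum-tabulate-punchIn g i) ⟩
  sum (tabulate g)                             ∎
  where
  open Data.Nat.Properties.≤-Reasoning
  j′ = punchOut i≢j
  k′ = punchOut i≢k
  j′≢k′ : j′ ≢ k′
  j′≢k′ e = j≢k (trans (sym (punchIn-punchOut i≢j)) (trans (cong (punchIn i) e) (punchIn-punchOut i≢k)))

sum-tabulate-≤-1 : ∀ {N} (g : Fin N → ℕ) a → (∀ i → g i ≤ 1) → (∀ i → i ≢ a → g i ≡ 0) →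
                   sum (tabulate g) ≤ 1
sum-tabulate-≤-1 {suc N} g a g≤1 g≡0 = begin
  sum (tabulate g)                      ≡⟨ sum-tabulate-punchIn g a ⟩
  g a + sum (tabulate (g ∘ punchIn a))  ≡⟨ cong (g a +_) (sum-tabulate-zero _ (g≡0 _ ∘ punchInᵢ≢i a)) ⟩
  g a + 0                               ≤⟨ +-monoˡ-≤ 0 (g≤1 a) ⟩
  1                                     ∎
  where open Data.Nat.Properties.≤-Reasoning

sum-tabulate-≤-2 : ∀ {N} (g : Fin N → ℕ) a b → (∀ i → g i ≤ 1) → (∀ i → i ≢ a → i ≢ b → g i ≡ 0) →
                   sum (tabulate g) ≤ 2
sum-tabulate-≤-2 {suc N} g a b g≤1 g≡0 with a ≟F b
... | yes refl = ≤-trans (sum-tabulate-≤-1 g a g≤1 (λ i i≢a → g≡0 i i≢a i≢a)) (n≤1+n 1)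
... | no a≢b = begin
  sum (tabulate g)                      ≡⟨ sum-tabulate-punchIn g a ⟩
  g a + sum (tabulate (g ∘ punchIn a))  ≤⟨ +-mono-≤ (g≤1 a) (sum-tabulate-≤-1 _ b′ (g≤1 ∘ punchIn a) rest≡0) ⟩
  2                                     ∎
  where
  open Data.Nat.Properties.≤-Reasoning
  b′ = punchOut a≢b
  rest≡0 : ∀ i → i ≢ b′ → g (punchIn a i) ≡ 0
  rest≡0 i i≢b′ = g≡0 _ (punchInᵢ≢i a i)
    (λ e → i≢b′ (punchIn-injective a i b′ (trans e (sym (punchIn-punchOut a≢b)))))

Edge : ∀ {N} → Graph N → Fin N → Fin N → Set
Edge G u v = adj G u v ≡ true

module Neighbourhood {N : ℕ} (G : Graph N) where

  infix 4 _∼_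
  _∼_ : Fin N → Fin N → Set
  _∼_ = Edge G

  ∼-sym : ∀ {u v} → u ∼ v → v ∼ u
  ∼-sym {u} {v} e = trans (Graph.sym G v u) e

  false⇒≁ : ∀ {u v} → adj G u v ≡ false → ¬ u ∼ v
  false⇒≁ f e with trans (sym e) f
  ... | ()

  ∼-irrefl : ∀ {u v} → u ∼ v → u ≢ v
  ∼-irrefl {u} e refl = false⇒≁ (irrfl G u) e

  private
    indicator : Fin N → Fin N → ℕ
    indicator u v = if adj G u v then 1 else 0

    deg≡sum : ∀ u → deg G u ≡ sum (tabulate (indicator u))
    deg≡sum u = cong sum (map-tabulate (λ v → v) (indicator u))

    indicator-≤1 : ∀ u v → indicator u v ≤ 1
    indicator-≤1 u v with adj G u v
    ... | true  = ≤-refl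
    ... | false = z≤n

    indicator-edge : ∀ {u v} → u ∼ v → indicator u v ≡ 1
    indicator-edge e rewrite e = refl

    indicator-non-edge : ∀ {u v} → ¬ u ∼ v → indicator u v ≡ 0
    indicator-non-edge {u} {v} ¬e with adj G u v
    ... | true  = ⊥-elim (¬e refl)
    ... | false = refl

  2≤deg : ∀ {u a b} → u ∼ a → u ∼ b → a ≢ b → 2 ≤ deg G u
  2≤deg {u} {a} {b} ua ub a≢b = begin
    2                              ≡⟨ cong₂ _+_ (sym (indicator-edge ua)) (sym (indicator-edge ub)) ⟩
    indicator u a + indicator u b  ≤⟨ +-≤-sum-tabulate (indicator u) a≢b ⟩
    sum (tabulate (indicator u))   ≡⟨ sym (deg≡sum u) ⟩
    deg G u                        ∎
    where open Data.Nat.Properties.≤-Reasoning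

  3≤deg : ∀ {u a b c} → u ∼ a → u ∼ b → u ∼ c → a ≢ b → a ≢ c → b ≢ c → 3 ≤ deg G u
  3≤deg {u} {a} {b} {c} ua ub uc a≢b a≢c b≢c = begin
    3                                              ≡⟨ cong₂ _+_ (cong₂ _+_ (sym (indicator-edge ua))
                                                                           (sym (indicator-edge ub)))
                                                                (sym (indicator-edge uc)) ⟩
    indicator u a + indicator u b + indicator u c  ≤⟨ +-+-≤-sum-tabulate (indicator u) a≢b a≢c b≢c ⟩
    sum (tabulate (indicator u))                   ≡⟨ sym (deg≡sum u) ⟩
    deg G u                                        ∎
    where open Data.Nat.Properties.≤-Reasoning

  deg≤1 : ∀ {u} a → (∀ v → u ∼ v → v ≡ a) → deg G u ≤ 1
  deg≤1 {u} a nbrs = subst (_≤ 1) (sym (deg≡sum u))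
    (sum-tabulate-≤-1 (indicator u) a (indicator-≤1 u) (λ v v≢a → indicator-non-edge (v≢a ∘ nbrs v)))

  deg≤2 : ∀ {u} a b → (∀ v → u ∼ v → v ≡ a ⊎ v ≡ b) → deg G u ≤ 2
  deg≤2 {u} a b nbrs = subst (_≤ 2) (sym (deg≡sum u))
    (sum-tabulate-≤-2 (indicator u) a b (indicator-≤1 u)
      (λ v v≢a v≢b → indicator-non-edge ([ v≢a , v≢b ]′ ∘ nbrs v)))

  deg≡2-neighbours : ∀ {u a b c} → deg G u ≡ 2 → u ∼ a → u ∼ b → a ≢ b → u ∼ c → c ≡ a ⊎ c ≡ b
  deg≡2-neighbours {a = a} {b} {c} d ua ub a≢b uc with c ≟F a | c ≟F b
  ... | yes c≡a | _       = inj₁ c≡a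
  ... | no _    | yes c≡b = inj₂ c≡b
  ... | no c≢a  | no c≢b  with subst (3 ≤_) d (3≤deg ua ub uc a≢b (≢-sym c≢a) (≢-sym c≢b))
  ...   | s≤s (s≤s ())

  neighbour-beyond? : ∀ u a b → (∃ λ v → u ∼ v × v ≢ a × v ≢ b) ⊎ (∀ v → u ∼ v → v ≡ a ⊎ v ≡ b)
  neighbour-beyond? u a b with any? (λ v → (adj G u v ≟B true) ×-dec ¬? (v ≟F a) ×-dec ¬? (v ≟F b))
  ... | yes beyond = inj₁ beyond
  ... | no none    = inj₂ within
    where
    within : ∀ v → u ∼ v → v ≡ a ⊎ v ≡ b
    within v e with v ≟F a | v ≟F b
    ... | yes v≡a | _       = inj₁ v≡a
    ... | no _    | yes v≡b = inj₂ v≡b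
    ... | no v≢a  | no v≢b  = ⊥-elim (none (v , e , v≢a , v≢b))

module _ {A : Set} {R : A → A → Set} where

  Linked-prefix : ∀ xs {y ys} → Linked R (xs ++ y ∷ ys) → Linked R (xs ++ [ y ])
  Linked-prefix []           _        = [-]
  Linked-prefix (_ ∷ [])     (r ∷ _)  = r ∷ [-]
  Linked-prefix (_ ∷ _ ∷ xs) (r ∷ rs) = r ∷ Linked-prefix (_ ∷ xs) rs

  Linked-join : ∀ xs {y ys} → Linked R (xs ++ [ y ]) → Linked R (y ∷ ys) → Linked R (xs ++ y ∷ ys)
  Linked-join []           _        rs′ = rs′
  Linked-join (_ ∷ [])     (r ∷ _)  rs′ = r ∷ rs′
  Linked-join (_ ∷ _ ∷ xs) (r ∷ rs) rs′ = r ∷ Linked-join (_ ∷ xs) rs rs′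

  Linked-reverse : (∀ {a b} → R a b → R b a) → ∀ {xs} → Linked R xs → Linked R (reverse xs)
  Linked-reverse R-sym {[]}    [] = []
  Linked-reverse R-sym {_ ∷ _} rs = onto rs [-]
    where
    onto : ∀ {y ys acc} → Linked R (y ∷ ys) → Linked R (y ∷ acc) → Linked R (reverseAcc (y ∷ acc) ys)
    onto {ys = []}    _        ra = ra
    onto {ys = _ ∷ _} (r ∷ rs) ra = onto rs (R-sym r ∷ ra)

  Linked-lookup : ∀ {y ys zs} → Linked R ((y ∷ ys) ++ zs) → (j : Fin (length ys)) →
                  R (lookup (y ∷ ys) (inject₁ j)) (lookup (y ∷ ys) (suc j))
  Linked-lookup {ys = _ ∷ _} (r ∷ _)  zero    = r
  Linked-lookup {ys = _ ∷ ys} (_ ∷ rs) (suc j) = Linked-lookup {ys = ys} rs j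

  Linked-last : ∀ {y ys z} → Linked R ((y ∷ ys) ++ [ z ]) → R (lookup (y ∷ ys) (fromℕ (length ys))) z
  Linked-last {ys = []}    (r ∷ _)  = r
  Linked-last {ys = _ ∷ ys} (_ ∷ rs) = Linked-last {ys = ys} rs

module _ {A : Set} where

  Unique-↭ : ∀ {xs ys : List A} → xs ↭ ys → Unique xs → Unique ys
  Unique-↭ xs↭ys = Unique-resp-↭ (setoid A) (↭⇒↭ₛ xs↭ys)

  Unique-++⁻ˡ : ∀ xs {ys : List A} → Unique (xs ++ ys) → Unique xs
  Unique-++⁻ˡ []       _          = []
  Unique-++⁻ˡ (_ ∷ xs) (x∉ ∷ uq) = Allₚ.++⁻ˡ xs x∉ ∷ Unique-++⁻ˡ xs uq

  lookup-injective : ∀ {xs : List A} → Unique xs → ∀ {i j} → lookup xs i ≡ lookup xs j → i ≡ j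
  lookup-injective (_  ∷ _)  {zero}  {zero}  _ = refl
  lookup-injective (x∉ ∷ _)  {zero}  {suc j} e = ⊥-elim (All.lookup x∉ (∈-lookup j) e)
  lookup-injective (x∉ ∷ _)  {suc i} {zero}  e = ⊥-elim (All.lookup x∉ (∈-lookup i) (sym e))
  lookup-injective (_  ∷ uq) {suc i} {suc j} e = cong suc (lookup-injective uq e)

Unique⇒length≤ : ∀ {N} {xs : List (Fin N)} → Unique xs → length xs ≤ N
Unique⇒length≤ uq = injective⇒≤ (lookup-injective uq)

toℕ-next : ∀ {k} (i : Fin (suc k)) → toℕ (next i) ≡ suc (toℕ i) % suc k
toℕ-next i = toℕ-fromℕ< _

next-inject₁ : ∀ {k} (j : Fin k) → next (inject₁ j) ≡ suc j
next-inject₁ {k} j = toℕ-injective (begin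
  toℕ (next (inject₁ j))         ≡⟨ toℕ-next (inject₁ j) ⟩
  suc (toℕ (inject₁ j)) % suc k  ≡⟨ cong (λ a → suc a % suc k) (toℕ-inject₁ j) ⟩
  suc (toℕ j) % suc k            ≡⟨ m<n⇒m%n≡m (s≤s (toℕ<n j)) ⟩
  suc (toℕ j)                    ∎)
  where open ≡-Reasoning

next-fromℕ : ∀ k → next (fromℕ k) ≡ zero
next-fromℕ k = toℕ-injective (begin
  toℕ (next (fromℕ k))         ≡⟨ toℕ-next (fromℕ k) ⟩
  suc (toℕ (fromℕ k)) % suc k  ≡⟨ cong (λ a → suc a % suc k) (toℕ-fromℕ k) ⟩
  suc k % suc k                ≡⟨ n%n≡0 (suc k) ⟩
  0                            ∎)
  where open ≡-Reasoning

predecessor : ∀ {k} (i : Fin (suc k)) → ∃ λ p → next p ≡ i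
predecessor zero    = fromℕ _ , next-fromℕ _
predecessor (suc j) = inject₁ j , next-inject₁ j

next∘next≢id : ∀ {m} (i : Fin (3 + m)) → next (next i) ≢ i
next∘next≢id {m} i with view i
... | ‵fromℕ = λ e → case trans (sym (cong next (next-fromℕ (2 + m)))) e of λ ()
... | ‵inject₁ j = next-suc≢inject₁ j ∘ trans (sym (cong next (next-inject₁ j)))
  where
  suc∘suc≢inject₁∘inject₁ : ∀ {k} (a : Fin k) → Fin.suc (suc a) ≢ inject₁ (inject₁ a)
  suc∘suc≢inject₁∘inject₁ zero    ()
  suc∘suc≢inject₁∘inject₁ (suc a) e = suc∘suc≢inject₁∘inject₁ a (suc-injective e)

  next-suc≢inject₁ : ∀ {k} (j : Fin (2 + k)) → next (suc j) ≢ inject₁ j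
  next-suc≢inject₁ {k} j with view j
  ... | ‵fromℕ      = λ e → case trans (sym (next-fromℕ (2 + k))) e of λ ()
  ... | ‵inject₁ j′ = suc∘suc≢inject₁∘inject₁ j′ ∘ trans (sym (next-inject₁ (suc j′)))

module Cycles {N : ℕ} (G : Graph N) where

  open Neighbourhood G

  closedWalk⇒Cycle : ∀ {h a b rest} → Unique (h ∷ a ∷ b ∷ rest) →
                     Linked _∼_ ((h ∷ a ∷ b ∷ rest) ++ [ h ]) → Cycle G
  closedWalk⇒Cycle {h} {a} {b} {rest} uq walk = record
    { m     = length rest
    ; vtx   = lookup L
    ; inj   = lookup-injective uq
    ; edges = edge
    }
    where
    L = h ∷ a ∷ b ∷ rest
    edge : ∀ i → lookup L i ∼ lookup L (next i)
    edge i with view i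
    ... | ‵fromℕ     = subst (λ j → lookup L (fromℕ _) ∼ lookup L j) (sym (next-fromℕ _))
                             (Linked-last {ys = a ∷ b ∷ rest} walk)
    ... | ‵inject₁ j = subst (λ j′ → lookup L (inject₁ j) ∼ lookup L j′) (sym (next-inject₁ j))
                             (Linked-lookup {ys = a ∷ b ∷ rest} walk j)

  module _ (C : Cycle G) where

    cycle-neighbours-of-deg≡2 : ∀ i j → deg G (vtx C i) ≡ 2 → vtx C i ∼ vtx C j → j ≡ next i ⊎ i ≡ next j
    cycle-neighbours-of-deg≡2 i j d e with predecessor i
    ... | p , refl with deg≡2-neighbours d (edges C (next p)) (∼-sym (edges C p)) next≢p e
      where
      next≢p : vtx C (next (next p)) ≢ vtx C p
      next≢p = next∘next≢id p ∘ inj C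
    ...   | inj₁ e′ = inj₁ (inj C e′)
    ...   | inj₂ e′ = inj₂ (cong next (sym (inj C e′)))

    edges-of-deg≢2-on-cycle⇒Induced :
      (∀ i j → vtx C i ∼ vtx C j → deg G (vtx C i) ≢ 2 → deg G (vtx C j) ≢ 2 → j ≡ next i ⊎ i ≡ next j) →
      Induced C
    edges-of-deg≢2-on-cycle⇒Induced chords i j e with deg G (vtx C i) ≟ℕ 2 | deg G (vtx C j) ≟ℕ 2
    ... | yes dᵢ | _      = cycle-neighbours-of-deg≡2 i j dᵢ e
    ... | no _   | yes dⱼ = swap (cycle-neighbours-of-deg≡2 j i dⱼ (∼-sym e))
    ... | no dᵢ  | no dⱼ  = chords i j e dᵢ dⱼ

module _ {n : ℕ} {G : Graph (suc n)} {x : Fin (suc n)} where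

  Edge-∖ : ∀ {u v} (x≢u : x ≢ u) (x≢v : x ≢ v) → Edge G u v → Edge (G ∖ x) (punchOut x≢u) (punchOut x≢v)
  Edge-∖ x≢u x≢v = subst₂ (Edge G) (sym (punchIn-punchOut x≢u)) (sym (punchIn-punchOut x≢v))

  Cycle-∖ : (C : Cycle G) → (∀ i → x ≢ vtx C i) → Cycle (G ∖ x)
  Cycle-∖ C x∉C = record
    { m     = m C
    ; vtx   = λ i → punchOut (x∉C i)
    ; inj   = λ e → inj C (punchOut-injective (x∉C _) (x∉C _) e)
    ; edges = λ i → Edge-∖ (x∉C i) (x∉C (next i)) (edges C i)
    }

DegreeTwoCycleThrough : ∀ {N} → Graph N → Fin N → Set
DegreeTwoCycleThrough G x =
  Σ (Cycle G) λ C → Induced C × OnCycle C x ×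
    (∃ λ w → ∀ v → OnCycle C v → v ≢ x → v ≢ w → deg G v ≡ 2)

module PendantPaths {N : ℕ} (G : Graph N) (x : Fin N) where

  open Neighbourhood G
  open Cycles G

  closedWalk⇒DegreeTwoCycle :
    ∀ {h a b rest} t → let L = h ∷ a ∷ b ∷ rest in
    Unique L → Linked _∼_ (L ++ [ h ]) → x ∈ L →
    (∀ {v} → v ∈ L → v ≡ x ⊎ v ≡ t ⊎ deg G v ≡ 2) →
    (x ∼ t → ∃ λ i → lookup L i ≡ x × lookup L (next i) ≡ t) →
    DegreeTwoCycleThrough G x
  closedWalk⇒DegreeTwoCycle {h} {a} {b} {rest} t uq walk x∈L profile x∼t⇒step =
    C , edges-of-deg≢2-on-cycle⇒Induced C chords , (index x∈L , sym (lookup-index x∈L)) , (t , deg≡2)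
    where
    L = h ∷ a ∷ b ∷ rest
    C = closedWalk⇒Cycle uq walk

    exceptional : ∀ i → deg G (lookup L i) ≢ 2 → lookup L i ≡ x ⊎ lookup L i ≡ t
    exceptional i d with profile (∈-lookup i)
    ... | inj₁ iₓ        = inj₁ iₓ
    ... | inj₂ (inj₁ iₜ) = inj₂ iₜ
    ... | inj₂ (inj₂ d′) = ⊥-elim (d d′)

    step : ∀ i j → lookup L i ≡ x → lookup L j ≡ t → x ∼ t → j ≡ next i
    step i j iₓ jₜ e with x∼t⇒step e
    ... | k , kₓ , kₜ = trans (inj C {j} {next k} (trans jₜ (sym kₜ)))
                              (cong next (inj C {k} {i} (trans kₓ (sym iₓ))))

    chords : ∀ i j → lookup L i ∼ lookup L j → deg G (lookup L i) ≢ 2 → deg G (lookup L j) ≢ 2 →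
             j ≡ next i ⊎ i ≡ next j
    chords i j e dᵢ dⱼ with exceptional i dᵢ | exceptional j dⱼ
    ... | inj₁ iₓ | inj₁ jₓ = ⊥-elim (∼-irrefl e (trans iₓ (sym jₓ)))
    ... | inj₂ iₜ | inj₂ jₜ = ⊥-elim (∼-irrefl e (trans iₜ (sym jₜ)))
    ... | inj₁ iₓ | inj₂ jₜ = inj₁ (step i j iₓ jₜ (subst₂ _∼_ iₓ jₜ e))
    ... | inj₂ iₜ | inj₁ jₓ = inj₂ (step j i jₓ iₜ (subst₂ _∼_ jₓ iₜ (∼-sym e)))

    deg≡2 : ∀ v → OnCycle C v → v ≢ x → v ≢ t → deg G v ≡ 2
    deg≡2 v (i , refl) v≢x v≢t with profile (∈-lookup i)
    ... | inj₁ vₓ        = ⊥-elim (v≢x vₓ)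
    ... | inj₂ (inj₁ vₜ) = ⊥-elim (v≢t vₜ)
    ... | inj₂ (inj₂ d)  = d

  record Pendant (t : Fin N) (Q : List (Fin N)) : Set where
    field
      walk   : Linked _∼_ (t ∷ Q ++ [ x ])
      unique : Unique (x ∷ t ∷ Q)
      deg≡2  : All (λ v → deg G v ≡ 2) Q
  open Pendant public

  pendant-tail : ∀ {t q Q} → Pendant t (q ∷ Q) → Pendant q Q
  pendant-tail P with unique P
  ... | (_ ∷ x∉) ∷ _ ∷ uq =
    record { walk = Linked.tail (walk P) ; unique = x∉ ∷ uq ; deg≡2 = All.tail (deg≡2 P) }

  pendant-base≢x : ∀ {t Q} → Pendant t Q → t ≢ x
  pendant-base≢x P with unique P
  ... | (x≢t ∷ _) ∷ _ = ≢-sym x≢t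

  pendant-base∉ : ∀ {t Q} → Pendant t Q → t ∉ Q
  pendant-base∉ P with unique P
  ... | _ ∷ t∉ ∷ _ = Allₚ.All¬⇒¬Any t∉

  pendant-successor : ∀ {t q Q} → Pendant t (q ∷ Q) → ∃ λ s → q ∼ s × t ≢ s × (s ≡ x ⊎ s ∈ Q)
  pendant-successor {Q = []} P =
    x , Linked.head (Linked.tail (walk P)) , pendant-base≢x P , inj₁ refl
  pendant-successor {Q = s ∷ _} P with unique P
  ... | _ ∷ (_ ∷ t≢s ∷ _) ∷ _ = s , Linked.head (Linked.tail (walk P)) , t≢s , inj₂ (here refl)

  -- Each vertex of Q has degree 2, so its neighbours are its two neighbours on the path t, Q, x.
  pendant-entry : ∀ {t q Q y v} → Pendant t (q ∷ Q) → y ∉ q ∷ Q → y ≢ x → y ∼ v → v ∈ q ∷ Q →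
                  y ≡ t × v ≡ q
  pendant-entry P y∉ y≢x yv (here refl) with pendant-successor P
  ... | s , qs , t≢s , s-loc
    with deg≡2-neighbours (All.head (deg≡2 P)) (∼-sym (Linked.head (walk P))) qs t≢s (∼-sym yv)
  ...   | inj₁ y≡t  = y≡t , refl
  ...   | inj₂ refl = ⊥-elim ([ y≢x , y∉ ∘ there ]′ s-loc)
  pendant-entry {Q = _ ∷ _} P y∉ y≢x yv (there v∈Q) =
    ⊥-elim (y∉ (here (proj₁ (pendant-entry (pendant-tail P) (y∉ ∘ there) y≢x yv v∈Q))))

  pendant-step-avoids : ∀ {t q Q y r R} → Pendant t (q ∷ Q) → Pendant y (r ∷ R) → y ∉ q ∷ Q → t ≢ y →
                        r ∉ q ∷ Q
  pendant-step-avoids P P′ y∉Q t≢y r∈Q =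
    t≢y (sym (proj₁ (pendant-entry P y∉Q (pendant-base≢x P′) (Linked.head (walk P′)) r∈Q)))

  pendant-avoids : ∀ {t q Q y R} → Pendant t (q ∷ Q) → Pendant y R → y ∉ q ∷ Q → t ∉ y ∷ R →
                   ∀ {v} → v ∈ R → v ∉ q ∷ Q
  pendant-avoids P P′ y∉Q t∉ (here refl) = pendant-step-avoids P P′ y∉Q (t∉ ∘ here)
  pendant-avoids P P′ y∉Q t∉ (there v∈R) =
    pendant-avoids P (pendant-tail P′) (pendant-step-avoids P P′ y∉Q (t∉ ∘ here)) (t∉ ∘ there) v∈R

  pendant-first-avoids : ∀ {t q Q q′ Q′} → Pendant t (q ∷ Q) → Pendant t (q′ ∷ Q′) → q ≢ q′ → q′ ∉ q ∷ Q
  pendant-first-avoids P P′ q≢q′ q′∈Q =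
    q≢q′ (sym (proj₂ (pendant-entry P (pendant-base∉ P) (pendant-base≢x P)
                                      (Linked.head (walk P′)) q′∈Q)))

  pendants-disjoint : ∀ {t q Q q′ Q′} → Pendant t (q ∷ Q) → Pendant t (q′ ∷ Q′) → q ≢ q′ →
                      Disjoint (q ∷ Q) (q′ ∷ Q′)
  pendants-disjoint P P′ q≢q′ (v∈Q , here refl)    = pendant-first-avoids P P′ q≢q′ v∈Q
  pendants-disjoint P P′ q≢q′ (v∈Q , there v∈Q′) =
    pendant-avoids P (pendant-tail P′) (pendant-first-avoids P P′ q≢q′) (pendant-base∉ P′) v∈Q′ v∈Q

  pendant-∷ : ∀ {p c u R} → Pendant c (u ∷ R) → p ∼ c → p ≢ x → p ≢ u → deg G c ≡ 2 →
              Pendant p (c ∷ u ∷ R)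
  pendant-∷ {p} P pc p≢x p≢u d with unique P
  ... | x∉ ∷ uq = record
    { walk   = pc ∷ walk P
    ; unique = (≢-sym p≢x ∷ x∉) ∷ Allₚ.¬Any⇒All¬ _ p∉ ∷ uq
    ; deg≡2  = d ∷ deg≡2 P
    }
    where
    p∉ : p ∉ _
    p∉ (here p≡c) = ∼-irrefl pc p≡c
    p∉ (there p∈) = p≢u (proj₂ (pendant-entry P (pendant-base∉ P) (pendant-base≢x P) (∼-sym pc) p∈))

  pendant-at-neighbour-of-x⇒cycle : ∀ {t q Q} → Pendant t (q ∷ Q) → t ∼ x → DegreeTwoCycleThrough G x
  pendant-at-neighbour-of-x⇒cycle {t} P t∼x =
    closedWalk⇒DegreeTwoCycle t (unique P) (∼-sym t∼x ∷ walk P) (here refl) profile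
      (λ _ → zero , refl , refl)
    where
    profile : ∀ {v} → v ∈ x ∷ t ∷ _ → v ≡ x ⊎ v ≡ t ⊎ deg G v ≡ 2
    profile (here v≡x)          = inj₁ v≡x
    profile (there (here v≡t))  = inj₂ (inj₁ v≡t)
    profile (there (there v∈Q)) = inj₂ (inj₂ (All.lookup (deg≡2 P) v∈Q))

  two-pendants⇒cycle : ∀ {t q Q q′ Q′} → Pendant t (q ∷ Q) → Pendant t (q′ ∷ Q′) → q ≢ q′ → ¬ t ∼ x →
                       DegreeTwoCycleThrough G x
  two-pendants⇒cycle {t} {q} {Q} {q′} {Q′} P P′ q≢q′ t≁x =
    closedWalk⇒DegreeTwoCycle t (Unique-↭ (↭-sym rotation) sorted-unique) cycle-walk
      (there (∈-++⁺ʳ A (here refl))) profile (⊥-elim ∘ t≁x ∘ ∼-sym)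
    where
    A = t ∷ q ∷ Q

    rotation : q′ ∷ A ++ x ∷ reverse Q′ ↭ x ∷ A ++ q′ ∷ Q′
    rotation = begin
      q′ ∷ A ++ x ∷ reverse Q′  ↭⟨ shift x (q′ ∷ A) (reverse Q′) ⟩
      x ∷ q′ ∷ A ++ reverse Q′  ↭⟨ prep x (↭-sym (shift q′ A (reverse Q′))) ⟩
      x ∷ A ++ q′ ∷ reverse Q′  ↭⟨ prep x (++⁺ˡ A (prep q′ (↭-reverse Q′))) ⟩
      x ∷ A ++ q′ ∷ Q′          ∎
      where open PermutationReasoning

    sorted-unique : Unique (x ∷ A ++ q′ ∷ Q′)
    sorted-unique with unique P | unique P′
    ... | (x≢t ∷ x∉Q) ∷ t∉Q ∷ uqQ | (_ ∷ x∉Q′) ∷ t∉Q′ ∷ uqQ′ =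
      (x≢t ∷ Allₚ.++⁺ x∉Q x∉Q′) ∷ Allₚ.++⁺ t∉Q t∉Q′ ∷ Unique.++⁺ uqQ uqQ′ (pendants-disjoint P P′ q≢q′)

    reverse-walk : reverse (q′ ∷ Q′ ++ [ x ]) ≡ x ∷ reverse Q′ ++ [ q′ ]
    reverse-walk = trans (reverse-++ (q′ ∷ Q′) [ x ]) (cong (x ∷_) (unfold-reverse q′ Q′))

    cycle-walk : Linked _∼_ ((q′ ∷ A ++ x ∷ reverse Q′) ++ [ q′ ])
    cycle-walk = ∼-sym (Linked.head (walk P′)) ∷
      subst (Linked _∼_) (sym (++-assoc A (x ∷ reverse Q′) [ q′ ]))
        (Linked-join A (walk P)
          (subst (Linked _∼_) reverse-walk (Linked-reverse ∼-sym (Linked.tail (walk P′)))))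

    profile : ∀ {v} → v ∈ q′ ∷ A ++ x ∷ reverse Q′ → v ≡ x ⊎ v ≡ t ⊎ deg G v ≡ 2
    profile (here refl)         = inj₂ (inj₂ (All.head (deg≡2 P′)))
    profile (there (here refl)) = inj₂ (inj₁ refl)
    profile (there (there v∈)) with ∈-++⁻ (q ∷ Q) v∈
    ... | inj₁ v∈Q          = inj₂ (inj₂ (All.lookup (deg≡2 P) v∈Q))
    ... | inj₂ (here refl)  = inj₁ refl
    ... | inj₂ (there v∈Q′) = inj₂ (inj₂ (All.lookup (deg≡2 P′) (there (reverse⁻ v∈Q′))))

module Explore {n : ℕ} (G : Graph (suc n)) (x : Fin (suc n)) (forest : Forest (G ∖ x))
               (no-leaf : ¬ (∃ λ v → v ≢ x × adj G x v ≡ false × deg G v ≤ 1)) where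

  open Neighbourhood G
  open Cycles G
  open PendantPaths G x

  V : Set
  V = Fin (suc n)

  -- Paths of G ∖ x, as lists of vertices of G: Unique (x ∷ L) says that L is simple and avoids x.
  ForestPath : List V → Set
  ForestPath L = Unique (x ∷ L) × Linked _∼_ L

  no-closed-walk-avoiding-x : ∀ {h a b rest} → Unique (x ∷ h ∷ a ∷ b ∷ rest) →
                              ¬ Linked _∼_ ((h ∷ a ∷ b ∷ rest) ++ [ h ])
  no-closed-walk-avoiding-x (x∉ ∷ uq) walk =
    forest (Cycle-∖ (closedWalk⇒Cycle uq walk) (λ i → All.lookup x∉ (∈-lookup i)))

  fresh-neighbour : ∀ {c p rest u} → ForestPath (c ∷ p ∷ rest) → c ∼ u → u ≢ p → u ∉ c ∷ p ∷ rest
  fresh-neighbour _ cu _   (here u≡c)         = ∼-irrefl cu (sym u≡c)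
  fresh-neighbour _ _  u≢p (there (here u≡p)) = u≢p u≡p
  fresh-neighbour {c} {p} {u = u} (uq , path) cu _ (there (there u∈rest)) with ∈-∃++ u∈rest
  ... | ys , zs , refl = no-closed-walk-avoiding-x cycle-unique cycle-walk
    where
    cycle-unique : Unique (x ∷ u ∷ c ∷ p ∷ ys)
    cycle-unique = Unique-++⁻ˡ (x ∷ u ∷ c ∷ p ∷ ys) (Unique-↭ (prep x (shift u (c ∷ p ∷ ys) zs)) uq)
    cycle-walk : Linked _∼_ ((u ∷ c ∷ p ∷ ys) ++ [ u ])
    cycle-walk = ∼-sym cu ∷ Linked-prefix (c ∷ p ∷ ys) path

  extend : ∀ {c p rest u} → ForestPath (c ∷ p ∷ rest) → c ∼ u → u ≢ p → u ≢ x →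
           ForestPath (u ∷ c ∷ p ∷ rest)
  extend sp@(x∉ ∷ uq , path) cu u≢p u≢x =
    (≢-sym u≢x ∷ x∉) ∷ Allₚ.¬Any⇒All¬ _ (fresh-neighbour sp cu u≢p) ∷ uq , ∼-sym cu ∷ path

  adjacent-to-x : ∀ {c a} → c ≢ x → (∀ v → c ∼ v → v ≡ a ⊎ v ≡ x) → c ∼ x
  adjacent-to-x {c} {a} c≢x within with adj G c x in cx
  ... | true  = refl
  ... | false = ⊥-elim (no-leaf (c , c≢x , trans (Graph.sym G x c) cx , deg≤1 a only-a))
    where
    only-a : ∀ v → c ∼ v → v ≡ a
    only-a v cv with within v cv
    ... | inj₁ v≡a = v≡a
    ... | inj₂ refl = ⊥-elim (false⇒≁ cx cv)

  pendant-at-dead-end : ∀ {c p rest} → ForestPath (c ∷ p ∷ rest) → (∀ v → c ∼ v → v ≡ p ⊎ v ≡ x) →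
                        Pendant p [ c ]
  pendant-at-dead-end {c} {p} ((x≢c ∷ x≢p ∷ _) ∷ (c≢p ∷ _) ∷ _ , cp ∷ _) within = record
    { walk   = ∼-sym cp ∷ cx ∷ [-]
    ; unique = (x≢p ∷ x≢c ∷ []) ∷ (≢-sym c≢p ∷ []) ∷ [] ∷ []
    ; deg≡2  = ≤-antisym (deg≤2 p x within) (2≤deg cp cx (≢-sym x≢p)) ∷ []
    }
    where
    cx : c ∼ x
    cx = adjacent-to-x (≢-sym x≢c) within

  PendantVia : V → V → Set
  PendantVia p c = ∃ λ R → Pendant p (c ∷ R)

  spend-fuel : ∀ k (L : List V) {u : V} → n < suc k + length L → n < k + length (u ∷ L)
  spend-fuel k _ fuel = subst (n <_) (sym (+-suc k _)) fuel

  mutual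
    explore : ∀ k {c p rest} → n < k + length (c ∷ p ∷ rest) → ForestPath (c ∷ p ∷ rest) →
              DegreeTwoCycleThrough G x ⊎ PendantVia p c
    explore zero fuel (uq , _) = ⊥-elim (<⇒≱ fuel (s≤s⁻¹ (Unique⇒length≤ uq)))
    explore (suc k) {c} {p} {rest} fuel sp with neighbour-beyond? c p x
    ... | inj₂ within = inj₂ ([] , pendant-at-dead-end sp within)
    ... | inj₁ (u , cu , u≢p , u≢x)
      with explore k (spend-fuel k (c ∷ p ∷ rest) {u} fuel) (extend sp cu u≢p u≢x)
    ...   | inj₁ found   = inj₁ found
    ...   | inj₂ (_ , P) = explore-with-pendant k fuel sp u≢p P

    explore-with-pendant : ∀ k {c p rest u R} → n < suc k + length (c ∷ p ∷ rest) →
                           ForestPath (c ∷ p ∷ rest) → u ≢ p → Pendant c (u ∷ R) →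
                           DegreeTwoCycleThrough G x ⊎ PendantVia p c
    explore-with-pendant k {c} {p} {rest} {u} fuel sp@((_ ∷ x≢p ∷ _) ∷ _ , cp ∷ _) u≢p P
      with adj G c x in cx
    ... | true  = inj₁ (pendant-at-neighbour-of-x⇒cycle P cx)
    ... | false with neighbour-beyond? c p u
    ...   | inj₂ within = inj₂ (_ , pendant-∷ P (∼-sym cp) (≢-sym x≢p) (≢-sym u≢p) deg≡2-c)
      where
      deg≡2-c : deg G c ≡ 2
      deg≡2-c = ≤-antisym (deg≤2 p u within) (2≤deg cp (Linked.head (walk P)) (≢-sym u≢p))
    ...   | inj₁ (u′ , cu′ , u′≢p , u′≢u) = inj₁ (close-with-second-pendant k
            (spend-fuel k (c ∷ p ∷ rest) {u′} fuel) (extend sp cu′ u′≢p u′≢x) P u′≢u (false⇒≁ cx))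
      where
      u′≢x : u′ ≢ x
      u′≢x refl = false⇒≁ cx cu′

    close-with-second-pendant : ∀ k {c u R u′ rest} → n < k + length (u′ ∷ c ∷ rest) →
                                ForestPath (u′ ∷ c ∷ rest) → Pendant c (u ∷ R) → u′ ≢ u → ¬ c ∼ x →
                                DegreeTwoCycleThrough G x
    close-with-second-pendant k fuel sp P u′≢u c≁x with explore k fuel sp
    ... | inj₁ found    = found
    ... | inj₂ (_ , P′) = two-pendants⇒cycle P P′ (≢-sym u′≢u) c≁x

  edge-path : ∀ {u v} → u ∼ v → u ≢ x → v ≢ x → ForestPath (v ∷ u ∷ [])
  edge-path uv u≢x v≢x =
    (≢-sym v≢x ∷ ≢-sym u≢x ∷ []) ∷ (∼-irrefl (∼-sym uv) ∷ []) ∷ [] ∷ [] , ∼-sym uv ∷ [-]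

  initial-fuel : n < n + 2
  initial-fuel = m<m+n n (s≤s z≤n)

  pendant⇒cycle : ∀ {u v R} → u ≢ x → Pendant u (v ∷ R) → DegreeTwoCycleThrough G x
  pendant⇒cycle {u} {v} u≢x P with adj G u x in ux
  ... | true  = pendant-at-neighbour-of-x⇒cycle P ux
  ... | false with neighbour-beyond? u v x
  ...   | inj₂ within = ⊥-elim (false⇒≁ ux (adjacent-to-x u≢x within))
  ...   | inj₁ (u′ , uu′ , u′≢v , u′≢x) =
    close-with-second-pendant n initial-fuel (edge-path uu′ u≢x u′≢x) P u′≢v (false⇒≁ ux)

  cycle-from-edge : ∀ {u v} → u ∼ v → u ≢ x → v ≢ x → DegreeTwoCycleThrough G x
  cycle-from-edge uv u≢x v≢x with explore n initial-fuel (edge-path uv u≢x v≢x)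
  ... | inj₁ found   = found
  ... | inj₂ (_ , P) = pendant⇒cycle u≢x P

module _ {n : ℕ} (G : Graph (suc n)) (x : Fin (suc n)) where

  open Neighbourhood G

  dominating-if-edgeless : ¬ (∃ λ v → v ≢ x × adj G x v ≡ false × deg G v ≤ 1) →
                           ¬ (∃₂ λ u v → Edge (G ∖ x) u v) → ∀ v → v ≡ x ⊎ x ∼ v
  dominating-if-edgeless no-leaf no-edge v with v ≟F x | adj G x v in xv
  ... | yes v≡x | _     = inj₁ v≡x
  ... | no _    | true  = inj₂ refl
  ... | no v≢x  | false = ⊥-elim (no-leaf (v , v≢x , xv , deg≤1 v isolated))
    where
    isolated : ∀ w → v ∼ w → w ≡ v
    isolated w vw with w ≟F x
    ... | no w≢x  = ⊥-elim (no-edge (_ , _ , Edge-∖ {G = G} (≢-sym v≢x) (≢-sym w≢x) vw))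
    ... | yes refl = ⊥-elim (false⇒≁ xv (∼-sym vw))

lemma4p1 : ∀ {n} (G : Graph (suc n)) (x : Fin (suc n)) →
    Forest (G ∖ x) →
    ((∀ v → v ≡ x ⊎ adj G x v ≡ true) × (∀ u v → adj (G ∖ x) u v ≡ false))
    ⊎ (∃ λ v → v ≢ x × adj G x v ≡ false × deg G v ≤ 1)
    ⊎ (Σ (Cycle G) λ C → Induced C × OnCycle C x ×
         (∃ λ w → ∀ v → OnCycle C v → v ≢ x → v ≢ w → deg G v ≡ 2))
lemma4p1 G x forest with any? (λ v → ¬? (v ≟F x) ×-dec (adj G x v ≟B false) ×-dec (deg G v ≤? 1))
... | yes leaf   = inj₂ (inj₁ leaf)
... | no no-leaf with any? (λ u → any? (λ v → adj (G ∖ x) u v ≟B true))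
...   | yes (u , v , e) =
  inj₂ (inj₂ (Explore.cycle-from-edge G x forest no-leaf e (punchInᵢ≢i x u) (punchInᵢ≢i x v)))
...   | no no-edge =
  inj₁ (dominating-if-edgeless G x no-leaf no-edge , λ u v → ¬-not (λ e → no-edge (u , v , e)))
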